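{- Let $M$ be a $\lambda_\oplus$-term and $s\in\mathcal T(M)$. Then $T(M)_s=\dfrac1{m(s)}$.
   Context: $\lambda_\oplus$-terms are given by $M,N,P,Q ::= x\mid\lambda x.M\mid MN\mid M\oplus N$ up to renaming of bound variables. Resource terms and resource monomials are defined by mutual induction: $s,t ::= x\mid\lambda x.s\mid\langle s\rangle\bar t\mid s\oplus\bullet\mid\bullet\oplus s$ and $\bar t ::= [t_1,\dots,t_n]$, where monomials are finite multisets of resource terms ($\bar t\cdot\bar u$ is multiset union). For a set $X$, $\mathbb V(X)$ is the set of functions $X\to\mathbb Q_{\ge0}$, written as possibly infinite linear combinations $A=\sum_{a\in X}A_a\,a$, with $\mathrm{supp}(A)=\{a\mid A_a\ne0\}$. Constructors are extended componentwise: $\lambda x.S=\sum_sS_s\,\lambda x.s$, $S\oplus\bullet=\sum_sS_s(s\oplus\bullet)$, $\bullet\oplus S=\sum_sS_s(\bullet\oplus s)$, $\langle S\rangle\bar T=\sum_{s,\bar t}S_s\bar T_{\bar t}\,\langle s\rangle\bar t$, $[S_1,\dots,S_n]=\sum_{(s_1,\dots,s_n)}(\prod_i(S_i)_{s_i})[s_1,\dots,s_n]$. Let $S^n=[S,\dots,S]$ ($n$ copies; $S^0=[]$) and $S^!=\sum_{n\ge0}\frac1{n!}S^n$. The Taylor expansion is $T(x)=x$, $T(\lambda x.N)=\lambda x.T(N)$, $T(PQ)=\langle T(P)\rangle(T(Q))^!$, $T(P\oplus Q)=(T(P)\oplus\bullet)+(\bullet\oplus T(Q))$, and $\mathcal T(M)=\mathrm{supp}(T(M))$.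 The multiplicity $m$ is defined by $m(x)=1$; $m(\lambda x.s)=m(s\oplus\bullet)=m(\bullet\oplus s)=m(s)$; $m(\langle s\rangle\bar t)=m(s)m(\bar t)$; $m([t_1]^{n_1}\cdot\ldots\cdot[t_k]^{n_k})=\prod_{i=1}^kn_i!\,m(t_i)^{n_i}$ for pairwise distinct $t_i$, where $[t]^n$ is the multiset with $n$ copies of $t$. -}

module Defs where

open import Data.Bool using (Bool; true; false; if_then_else_; _∧_)
open import Data.Nat as ℕ using (ℕ; zero; suc; _!; NonZero)
open import Data.Nat.Properties using (_!≢0; m*n≢0; _≟_)
open import Data.List using (List; []; _∷_; length; replicate)
open import Data.Maybe using (Maybe; just; nothing)
open import Data.Integer using (+_)
open import Data.Rational using (ℚ; 0ℚ; 1ℚ; _+_; _*_; _/_)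
open import Relation.Nullary using (does; ¬_)
open import Relation.Binary.PropositionalEquality using (_≡_)

-- λ⊕-terms, up to α-renaming: de Bruijn indices.

data Λ : Set where
  var : ℕ → Λ
  lam : Λ → Λ
  app : Λ → Λ → Λ
  _⊕_ : Λ → Λ → Λ

-- A monomial [t₁,…,tₙ] is represented
-- by a list; monomials are finite MULTISETS, i.e. lists are identified up
-- to permutation (recursively), see _≈ᵇ_ below.
--   left s  is  s ⊕ •      right s  is  • ⊕ s

data RTerm : Set where
  var   : ℕ → RTerm
  lam   : RTerm → RTerm
  app   : RTerm → List RTerm → RTerm
  left  : RTerm → RTerm
  right : RTerm → RTerm

Monomial : Set
Monomial = List RTerm

mutual
  _≈ᵇ_ : RTerm → RTerm → Bool
  var i   ≈ᵇ var j     = does (i ≟ j)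
  lam s   ≈ᵇ lam s′    = s ≈ᵇ s′
  app s ts ≈ᵇ app s′ us = (s ≈ᵇ s′) ∧ (ts ≈ₘ us)
  left s  ≈ᵇ left s′   = s ≈ᵇ s′
  right s ≈ᵇ right s′  = s ≈ᵇ s′
  _       ≈ᵇ _         = false

  _≈ₘ_ : Monomial → Monomial → Bool
  []       ≈ₘ []  = true
  []       ≈ₘ (_ ∷ _) = false
  (t ∷ ts) ≈ₘ us with removeOne t us
  ... | just us′ = ts ≈ₘ us′
  ... | nothing  = false

  removeOne : RTerm → Monomial → Maybe Monomial
  removeOne t []       = nothing
  removeOne t (u ∷ us) with t ≈ᵇ u
  ... | true  = just us
  ... | false with removeOne t us
  ...   | just us′ = just (u ∷ us′)
  ...   | nothing  = nothing

-- t̄ minus one copy of t (unchanged if t does not occur)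
_∖_ : Monomial → RTerm → Monomial
us ∖ t with removeOne t us
... | just us′ = us′
... | nothing  = us

count : RTerm → Monomial → ℕ
count t []       = 0
count t (u ∷ us) = if t ≈ᵇ u then suc (count t us) else count t us

elemOf : RTerm → Monomial → Bool
elemOf t []       = false
elemOf t (u ∷ us) = if t ≈ᵇ u then true else elemOf t us

distinct : Monomial → Monomial
distinct []       = []
distinct (u ∷ us) = if elemOf u us then distinct us else u ∷ distinct us

-- 𝕍(X) = functions X → ℚ≥0, given by their coefficients.  A vector over
-- resource terms is a function on representatives (all vectors built
-- below are invariant under ≈ᵇ).

V : Set → Set
V X = X → ℚ

sumℚ : List ℚ → ℚ
sumℚ []       = 0ℚ
sumℚ (q ∷ qs) = q + sumℚ qs

mapL : {A B : Set} → (A → B) → List A → List B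
mapL f []       = []
mapL f (x ∷ xs) = f x ∷ mapL f xs

lamV : V RTerm → V RTerm
lamV S (lam s) = S s
lamV S _       = 0ℚ

leftV : V RTerm → V RTerm
leftV S (left s) = S s
leftV S _        = 0ℚ

rightV : V RTerm → V RTerm
rightV S (right s) = S s
rightV S _         = 0ℚ

appV : V RTerm → V Monomial → V RTerm
appV S T (app s ts) = S s * T ts
appV S T _          = 0ℚ

-- [S₁,…,Sₙ] : its coefficient at t̄ is the sum, over the tuples
-- (s₁,…,sₙ) with [s₁,…,sₙ] = t̄, of ∏ (Sᵢ)_{sᵢ}.  Such tuples are
-- enumerated by choosing s₁ among the distinct elements of t̄ and
-- recursing on t̄ minus one copy of s₁.
monoV : List (V RTerm) → V Monomial
monoV []       []      = 1ℚ
monoV []       (_ ∷ _) = 0ℚ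
monoV (S ∷ Ss) ts      =
  sumℚ (mapL (λ t → S t * monoV Ss (ts ∖ t)) (distinct ts))

powV : V RTerm → ℕ → V Monomial
powV S n = monoV (replicate n S)

-- S^! = Σₙ (1/n!) Sⁿ ; Sⁿ is supported on monomials of length n, so the
-- coefficient at t̄ only involves n = |t̄|.
bangV : V RTerm → V Monomial
bangV S ts = ((+ 1) / (length ts !)) {{length ts !≢0}} * powV S (length ts) ts

δ : RTerm → V RTerm
δ s t = if s ≈ᵇ t then 1ℚ else 0ℚ

T : Λ → V RTerm
T (var i)   = δ (var i)
T (lam N)   = lamV (T N)
T (app P Q) = appV (T P) (bangV (T Q))
T (P ⊕ Q)   = λ s → leftV (T P) s + rightV (T Q) s

_∈𝒯_ : RTerm → Λ → Set
s ∈𝒯 M = ¬ (T M s ≡ 0ℚ)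

-- multiplicity
-- m([t₁]^{n₁}·…·[t_k]^{n_k}) = ∏ nᵢ! m(tᵢ)^{nᵢ}
--   = (∏_{distinct t} (count t)!) · ∏_{all occurrences u} m(u)

factProd : Monomial → Monomial → ℕ
factProd ts []       = 1
factProd ts (u ∷ us) = (count u ts !) ℕ.* factProd ts us

mutual
  m : RTerm → ℕ
  m (var _)    = 1
  m (lam s)    = m s
  m (left s)   = m s
  m (right s)  = m s
  m (app s ts) = m s ℕ.* mₘ ts

  mₘ : Monomial → ℕ
  mₘ ts = factProd ts (distinct ts) ℕ.* mList ts

  mList : Monomial → ℕ
  mList []       = 1
  mList (u ∷ us) = m u ℕ.* mList us

factProd-nz : ∀ ts us → NonZero (factProd ts us)
factProd-nz ts []       = _
factProd-nz ts (u ∷ us) =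
  m*n≢0 _ _ {{count u ts !≢0}} {{factProd-nz ts us}}

mutual
  m-nz : ∀ s → NonZero (m s)
  m-nz (var _)    = _
  m-nz (lam s)    = m-nz s
  m-nz (left s)   = m-nz s
  m-nz (right s)  = m-nz s
  m-nz (app s ts) = m*n≢0 _ _ {{m-nz s}} {{mₘ-nz ts}}

  mₘ-nz : ∀ ts → NonZero (mₘ ts)
  mₘ-nz ts = m*n≢0 _ _ {{factProd-nz ts (distinct ts)}} {{mList-nz ts}}

  mList-nz : ∀ ts → NonZero (mList ts)
  mList-nz []       = _
  mList-nz (u ∷ us) = m*n≢0 _ _ {{m-nz u}} {{mList-nz us}}

-- Variables, abstractions and sums are
-- immediate; the content is in applications, where T(PQ) = ⟨T(P)⟩ T(Q)^!.
-- For a vector S respecting the equivalence ≈ of resource terms (monomials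
-- being multisets), the coefficient of Sⁿ at a monomial t̄ of length n is
-- n!·∏ᵢ S(tᵢ)/stab(t̄), where stab(t̄) = ∏ over distinct t of (count t t̄)!;
-- so S^! has coefficient ∏ᵢ S(tᵢ)/stab(t̄), which is 1/m(t̄) when every S(tᵢ)
-- is 1/m(tᵢ).

module Submission where

open import Defs
open import Data.Integer using (+_)
open import Data.Rational using (ℚ; _/_)
open import Relation.Binary.PropositionalEquality using (_≡_)

open import Data.Bool using (Bool; true; false; if_then_else_; _∧_) renaming (T to T-Bool)
open import Data.Empty using (⊥; ⊥-elim)
import Data.Integer as ℤ
import Data.Integer.Properties as ℤP
open import Data.List using ([]; _∷_; length)
open import Data.List.Membership.Propositional using (_∈_)
open import Data.List.Relation.Unary.All as All using (All; []; _∷_)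
open import Data.List.Relation.Unary.AllPairs using (AllPairs; []; _∷_)
open import Data.List.Relation.Unary.Any using (here; there)
open import Data.Maybe using (Maybe; just; nothing)
open import Data.Nat as ℕ using (ℕ; zero; suc; NonZero; _!; _≤_; s≤s; _⊔_)
open import Data.Nat.Properties as ℕP using (_!≢0)
open import Data.Product using (_×_; _,_; ∃; proj₁; proj₂)
import Data.Rational as ℚ
open import Data.Rational using (0ℚ; 1ℚ; toℚᵘ)
import Data.Rational.Properties as ℚP
open import Data.Rational.Solver using (module +-*-Solver)
open import Data.Rational.Unnormalised as U using (mkℚᵘ; *≡*)
import Data.Rational.Unnormalised.Properties as UP
open import Data.Unit using (⊤; tt)
open import Relation.Binary.PropositionalEquality using (refl; sym; trans; cong; cong₂; subst; module ≡-Reasoning)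
open import Relation.Nullary using (does; ¬_)

open import Algebra.Properties.CommutativeSemigroup ℕP.*-commutativeSemigroup using (x∙yz≈y∙xz)

open +-*-Solver

ι : ℕ → ℚ
ι n = (+ n) / 1

recip : (n : ℕ) → .{{NonZero n}} → ℚ
recip n = (+ 1) / n

ι-unnormalised : ∀ n → toℚᵘ (ι n) U.≃ mkℚᵘ (+ n) 0
ι-unnormalised n = ℚP.toℚᵘ-fromℚᵘ (mkℚᵘ (+ n) 0)

ι-+ : ∀ a b → ι (a ℕ.+ b) ≡ ι a ℚ.+ ι b
ι-+ a b = ℚP.toℚᵘ-injective (UP.≃-trans (ι-unnormalised (a ℕ.+ b))
  (UP.≃-trans (*≡* cross) (UP.≃-sym (UP.≃-trans (ℚP.toℚᵘ-homo-+ (ι a) (ι b))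
                                                (UP.+-cong (ι-unnormalised a) (ι-unnormalised b))))))
  where
  open ≡-Reasoning
  cross : + (a ℕ.+ b) ℤ.* + 1 ≡ (+ a ℤ.* + 1 ℤ.+ + b ℤ.* + 1) ℤ.* + 1
  cross = begin
    + (a ℕ.+ b) ℤ.* + 1             ≡⟨ ℤP.*-identityʳ _ ⟩
    + (a ℕ.+ b)                     ≡⟨ ℤP.pos-+ a b ⟩
    + a ℤ.+ + b                     ≡⟨ cong₂ ℤ._+_ (ℤP.*-identityʳ (+ a)) (ℤP.*-identityʳ (+ b)) ⟨
    + a ℤ.* + 1 ℤ.+ + b ℤ.* + 1     ≡⟨ ℤP.*-identityʳ _ ⟨
    (+ a ℤ.* + 1 ℤ.+ + b ℤ.* + 1) ℤ.* + 1 ∎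

ι-* : ∀ a b → ι (a ℕ.* b) ≡ ι a ℚ.* ι b
ι-* a b = ℚP.toℚᵘ-injective (UP.≃-trans (ι-unnormalised (a ℕ.* b))
  (UP.≃-trans (*≡* cross) (UP.≃-sym (UP.≃-trans (ℚP.toℚᵘ-homo-* (ι a) (ι b))
                                                (UP.*-cong (ι-unnormalised a) (ι-unnormalised b))))))
  where
  open ≡-Reasoning
  cross : + (a ℕ.* b) ℤ.* + 1 ≡ (+ a ℤ.* + b) ℤ.* + 1
  cross = begin
    + (a ℕ.* b) ℤ.* + 1   ≡⟨ ℤP.*-identityʳ _ ⟩
    + (a ℕ.* b)           ≡⟨ ℤP.pos-* a b ⟩
    + a ℤ.* + b           ≡⟨ ℤP.*-identityʳ _ ⟨
    (+ a ℤ.* + b) ℤ.* + 1 ∎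

recip-inverse : ∀ n .{{_ : NonZero n}} → recip n ℚ.* ι n ≡ 1ℚ
recip-inverse (suc k) = ℚP.toℚᵘ-injective (UP.≃-trans (ℚP.toℚᵘ-homo-* (recip (suc k)) (ι (suc k)))
  (UP.≃-trans (UP.*-cong (ℚP.toℚᵘ-fromℚᵘ (mkℚᵘ (+ 1) k)) (ι-unnormalised (suc k))) (*≡* cross)))
  where
  open ≡-Reasoning
  cross : (+ 1 ℤ.* + suc k) ℤ.* + 1 ≡ + 1 ℤ.* (+ (suc k ℕ.* 1))
  cross = begin
    (+ 1 ℤ.* + suc k) ℤ.* + 1 ≡⟨ ℤP.*-identityʳ _ ⟩
    + 1 ℤ.* + suc k           ≡⟨ cong (λ x → + 1 ℤ.* + x) (ℕP.*-identityʳ (suc k)) ⟨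
    + 1 ℤ.* (+ (suc k ℕ.* 1)) ∎

recip-solve : ∀ n .{{_ : NonZero n}} x {y} → x ℚ.* ι n ≡ y → x ≡ y ℚ.* recip n
recip-solve n x {y} e = begin
  x                              ≡⟨ ℚP.*-identityʳ x ⟨
  x ℚ.* 1ℚ                       ≡⟨ cong (x ℚ.*_) (recip-inverse n) ⟨
  x ℚ.* (recip n ℚ.* ι n)        ≡⟨ solve 3 (λ a b c → a :* (b :* c) := (a :* c) :* b) refl x (recip n) (ι n) ⟩
  (x ℚ.* ι n) ℚ.* recip n        ≡⟨ cong (ℚ._* recip n) e ⟩
  y ℚ.* recip n                  ∎
  where open ≡-Reasoning

recip-unique : ∀ n .{{_ : NonZero n}} x → x ℚ.* ι n ≡ 1ℚ → x ≡ recip n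
recip-unique n x e = trans (recip-solve n x e) (ℚP.*-identityˡ (recip n))

recip-* : ∀ a b .{{_ : NonZero a}} .{{_ : NonZero b}} .{{_ : NonZero (a ℕ.* b)}} →
          recip a ℚ.* recip b ≡ recip (a ℕ.* b)
recip-* a b = recip-unique (a ℕ.* b) _ (begin
  (recip a ℚ.* recip b) ℚ.* ι (a ℕ.* b)    ≡⟨ cong ((recip a ℚ.* recip b) ℚ.*_) (ι-* a b) ⟩
  (recip a ℚ.* recip b) ℚ.* (ι a ℚ.* ι b)  ≡⟨ solve 4 (λ x y z w → (x :* y) :* (z :* w) := (x :* z) :* (y :* w))
                                                     refl (recip a) (recip b) (ι a) (ι b) ⟩
  (recip a ℚ.* ι a) ℚ.* (recip b ℚ.* ι b)  ≡⟨ cong₂ ℚ._*_ (recip-inverse a) (recip-inverse b) ⟩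
  1ℚ                                       ∎)
  where open ≡-Reasoning

recip-cong : ∀ {a b} → a ≡ b → .{{_ : NonZero a}} .{{_ : NonZero b}} → recip a ≡ recip b
recip-cong refl = refl

_≈_ : RTerm → RTerm → Set
a ≈ b = a ≈ᵇ b ≡ true

_≉_ : RTerm → RTerm → Set
a ≉ b = a ≈ᵇ b ≡ false

data SameHead : RTerm → RTerm → Set where
  var   : ∀ i j → SameHead (var i) (var j)
  lam   : ∀ s t → SameHead (lam s) (lam t)
  app   : ∀ s ts t us → SameHead (app s ts) (app t us)
  left  : ∀ s t → SameHead (left s) (left t)
  right : ∀ s t → SameHead (right s) (right t)

sameHead : ∀ x y → x ≈ y → SameHead x y
sameHead (var i)    (var j)    _ = var i j
sameHead (lam s)    (lam t)    _ = lam s t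
sameHead (app s ts) (app t us) _ = app s ts t us
sameHead (left s)   (left t)   _ = left s t
sameHead (right s)  (right t)  _ = right s t
sameHead (var _)    (lam _)    ()
sameHead (var _)    (app _ _)  ()
sameHead (var _)    (left _)   ()
sameHead (var _)    (right _)  ()
sameHead (lam _)    (var _)    ()
sameHead (lam _)    (app _ _)  ()
sameHead (lam _)    (left _)   ()
sameHead (lam _)    (right _)  ()
sameHead (app _ _)  (var _)    ()
sameHead (app _ _)  (lam _)    ()
sameHead (app _ _)  (left _)   ()
sameHead (app _ _)  (right _)  ()
sameHead (left _)   (var _)    ()
sameHead (left _)   (lam _)    ()
sameHead (left _)   (app _ _)  ()
sameHead (left _)   (right _)  ()
sameHead (right _)  (var _)    ()
sameHead (right _)  (lam _)    ()
sameHead (right _)  (app _ _)  ()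
sameHead (right _)  (left _)   ()

-- count t (u ∷ us) ≡ bump (t ≈ᵇ u) (count t us) holds definitionally.
bump : Bool → ℕ → ℕ
bump b n = if b then suc n else n

bump-comm : ∀ a b n → bump a (bump b n) ≡ bump b (bump a n)
bump-comm true  true  n = refl
bump-comm true  false n = refl
bump-comm false true  n = refl
bump-comm false false n = refl

bump-injective : ∀ b {m n} → bump b m ≡ bump b n → m ≡ n
bump-injective true  refl = refl
bump-injective false e    = e

bump-true : ∀ {b} n → b ≡ true → bump b n ≡ suc n
bump-true n refl = refl

bump-false : ∀ {b} n → b ≡ false → bump b n ≡ n
bump-false n refl = refl

bool-ext : ∀ {a b : Bool} → (a ≡ true → b ≡ true) → (b ≡ true → a ≡ true) → a ≡ b
bool-ext {true}  {true}  f g = refl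
bool-ext {true}  {false} f g = sym (f refl)
bool-ext {false} {true}  f g = g refl
bool-ext {false} {false} f g = refl

∧-true : ∀ {a b} → a ∧ b ≡ true → a ≡ true × b ≡ true
∧-true {true} e = refl , e

true-∧ : ∀ {a b} → a ≡ true → b ≡ true → a ∧ b ≡ true
true-∧ refl refl = refl

≟-sound : ∀ {i j} → does (i ℕP.≟ j) ≡ true → i ≡ j
≟-sound {i} {j} e = ℕP.≡ᵇ⇒≡ i j (subst T-Bool (sym e) tt)

≟-refl : ∀ i → does (i ℕP.≟ i) ≡ true
≟-refl zero    = refl
≟-refl (suc i) = ≟-refl i

-- The recursion of _≈ₘ_ on its left argument, with the `with` made explicit.
≈ₘ-after : Monomial → Maybe Monomial → Bool
≈ₘ-after xs (just ys) = xs ≈ₘ ys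
≈ₘ-after xs nothing   = false

≈ₘ-∷ : ∀ x xs ys → (x ∷ xs) ≈ₘ ys ≡ ≈ₘ-after xs (removeOne x ys)
≈ₘ-∷ x xs ys with removeOne x ys
... | just _  = refl
... | nothing = refl

removeOne-head : ∀ t u us → t ≈ u → removeOne t (u ∷ us) ≡ just us
removeOne-head t u us e with t ≈ᵇ u
removeOne-head t u us refl | true = refl

mutual
  ≈-refl : ∀ x → x ≈ x
  ≈-refl (var i)    = ≟-refl i
  ≈-refl (lam s)    = ≈-refl s
  ≈-refl (left s)   = ≈-refl s
  ≈-refl (right s)  = ≈-refl s
  ≈-refl (app s ts) = true-∧ (≈-refl s) (≈ₘ-refl ts)

  ≈ₘ-refl : ∀ ts → ts ≈ₘ ts ≡ true
  ≈ₘ-refl []       = refl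
  ≈ₘ-refl (t ∷ ts) =
    trans (≈ₘ-∷ t ts (t ∷ ts)) (trans (cong (≈ₘ-after ts) (removeOne-head t t ts (≈-refl t))) (≈ₘ-refl ts))

data Del (u : RTerm) : Monomial → Monomial → Set where
  here  : ∀ {ys} → Del u (u ∷ ys) ys
  there : ∀ {y ys ys′} → Del u ys ys′ → Del u (y ∷ ys) (y ∷ ys′)

data RemoveOne (t : RTerm) (ys : Monomial) : Maybe Monomial → Set where
  found : ∀ u ys′ → t ≈ u → Del u ys ys′ → RemoveOne t ys (just ys′)
  none  : count t ys ≡ 0 → RemoveOne t ys nothing

removeOne-view : ∀ t ys → RemoveOne t ys (removeOne t ys)
removeOne-view t [] = none refl
removeOne-view t (u ∷ us) with t ≈ᵇ u in eq
... | true = found u us eq here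
... | false with removeOne t us | removeOne-view t us
...   | just us′ | found w .us′ e d = found w (u ∷ us′) e (there d)
...   | nothing  | none c           = none (trans (cong (λ b → bump b (count t us)) eq) c)

∖-removeOne : ∀ ts t ts′ → removeOne t ts ≡ just ts′ → ts ∖ t ≡ ts′
∖-removeOne ts t ts′ e with removeOne t ts
∖-removeOne ts t ts′ refl | just _ = refl

del-count : ∀ {u ys ys′} → Del u ys ys′ → ∀ z → count z ys ≡ bump (z ≈ᵇ u) (count z ys′)
del-count here              z = refl
del-count {u} (there {y} d) z = trans (cong (bump (z ≈ᵇ y)) (del-count d z)) (bump-comm (z ≈ᵇ y) (z ≈ᵇ u) _)

del-length : ∀ {u ys ys′} → Del u ys ys′ → length ys ≡ suc (length ys′)
del-length here      = refl
del-length (there d) = cong suc (del-length d)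

del-∈ : ∀ {u ys ys′} → Del u ys ys′ → u ∈ ys
del-∈ here      = here refl
del-∈ (there d) = there (del-∈ d)

del-All : ∀ {P : RTerm → Set} {u ys ys′} → Del u ys ys′ → All P ys → All P ys′
del-All here      (_ ∷ ps) = ps
del-All (there d) (p ∷ ps) = p ∷ del-All d ps

count-∷-self : ∀ t us → count t (t ∷ us) ≡ suc (count t us)
count-∷-self t us = bump-true (count t us) (≈-refl t)

∈⇒count≢0 : ∀ {t ys} → t ∈ ys → count t ys ≡ 0 → ⊥
∈⇒count≢0 {t} {_ ∷ ys} (here refl) c with trans (sym (count-∷-self t ys)) c
... | ()
∈⇒count≢0 {t} {y ∷ ys} (there m) c = ∈⇒count≢0 m (bump-zero (t ≈ᵇ y) c)
  where
  bump-zero : ∀ b {n} → bump b n ≡ 0 → n ≡ 0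
  bump-zero false e = e

removeOne-∈ : ∀ t ts → t ∈ ts → ∃ λ u → ∃ λ ts′ → removeOne t ts ≡ just ts′ × t ≈ u × Del u ts ts′
removeOne-∈ t ts m with removeOne t ts | removeOne-view t ts
... | just ts′ | found u .ts′ e d = u , ts′ , refl , e , d
... | nothing  | none c           = ⊥-elim (∈⇒count≢0 m c)

-- We state it relative
-- to a predicate P on which ≈ is already known to be an equivalence, so that
-- it can be used inside the induction proving that ≈ is an equivalence.
record EquivOn (P : RTerm → Set) : Set where
  field
    sym-on   : ∀ {x y} → P x → P y → x ≈ y → y ≈ x
    trans-on : ∀ {x y z} → P x → P y → P z → x ≈ y → y ≈ z → x ≈ z

module BagOn {P : RTerm → Set} (E : EquivOn P) where
  open EquivOn E

  ≈ᵇ-congʳ-on : ∀ {z a b} → P z → P a → P b → a ≈ b → z ≈ᵇ a ≡ z ≈ᵇ b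
  ≈ᵇ-congʳ-on pz pa pb e = bool-ext (λ za → trans-on pz pa pb za e) (λ zb → trans-on pz pb pa zb (sym-on pa pb e))

  bag⇒count : ∀ xs ys → All P xs → All P ys → xs ≈ₘ ys ≡ true → ∀ z → P z → count z xs ≡ count z ys
  bag⇒count []       []      _         _  _ z pz = refl
  bag⇒count (x ∷ xs) ys (px ∷ pxs) pys e z pz =
    step (removeOne x ys) (removeOne-view x ys) (trans (sym (≈ₘ-∷ x xs ys)) e)
    where
    step : (r : Maybe Monomial) → RemoveOne x ys r → ≈ₘ-after xs r ≡ true → count z (x ∷ xs) ≡ count z ys
    step (just ys′) (found u .ys′ x≈u d) e′ =
      trans (cong₂ bump (≈ᵇ-congʳ-on pz px (All.lookup pys (del-∈ d)) x≈u)
                        (bag⇒count xs ys′ pxs (del-All d pys) e′ z pz))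
            (sym (del-count d z))

  count⇒bag : ∀ xs ys → All P xs → All P ys → (∀ z → P z → count z xs ≡ count z ys) → xs ≈ₘ ys ≡ true
  count⇒bag []       []       _ _ h = refl
  count⇒bag []       (y ∷ ys) _ (py ∷ _) h with trans (h y py) (count-∷-self y ys)
  ... | ()
  count⇒bag (x ∷ xs) ys (px ∷ pxs) pys h = trans (≈ₘ-∷ x xs ys) (step (removeOne x ys) (removeOne-view x ys))
    where
    step : (r : Maybe Monomial) → RemoveOne x ys r → ≈ₘ-after xs r ≡ true
    step (just ys′) (found u .ys′ x≈u d) = count⇒bag xs ys′ pxs (del-All d pys) λ z pz →
      bump-injective (z ≈ᵇ x) (trans (h z pz) (trans (del-count d z)
        (cong (λ b → bump b (count z ys′)) (sym (≈ᵇ-congʳ-on pz px (All.lookup pys (del-∈ d)) x≈u)))))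
    step nothing (none c) with trans (sym c) (trans (sym (h x px)) (count-∷-self x xs))
    ... | ()

  bag-sym : ∀ xs ys → All P xs → All P ys → xs ≈ₘ ys ≡ true → ys ≈ₘ xs ≡ true
  bag-sym xs ys pxs pys e = count⇒bag ys xs pys pxs (λ z pz → sym (bag⇒count xs ys pxs pys e z pz))

  bag-trans : ∀ xs ys zs → All P xs → All P ys → All P zs →
              xs ≈ₘ ys ≡ true → ys ≈ₘ zs ≡ true → xs ≈ₘ zs ≡ true
  bag-trans xs ys zs pxs pys pzs e₁ e₂ =
    count⇒bag xs zs pxs pzs (λ z pz → trans (bag⇒count xs ys pxs pys e₁ z pz) (bag⇒count ys zs pys pzs e₂ z pz))

-- Size of a resource term, the induction measure for the equivalence proof.
mutual
  size : RTerm → ℕ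
  size (var _)    = 0
  size (lam s)    = suc (size s)
  size (left s)   = suc (size s)
  size (right s)  = suc (size s)
  size (app s ts) = suc (size s ℕ.+ sizeₘ ts)

  sizeₘ : Monomial → ℕ
  sizeₘ []       = 0
  sizeₘ (t ∷ ts) = size t ℕ.+ sizeₘ ts

Small : ℕ → RTerm → Set
Small n x = size x ≤ n

sizeₘ-bound : ∀ {n} ts → sizeₘ ts ≤ n → All (Small n) ts
sizeₘ-bound []       _ = []
sizeₘ-bound (t ∷ ts) p =
  ℕP.≤-trans (ℕP.m≤m+n (size t) (sizeₘ ts)) p ∷ sizeₘ-bound ts (ℕP.≤-trans (ℕP.m≤n+m (sizeₘ ts) (size t)) p)

small-fun : ∀ {n} s ts → Small (suc n) (app s ts) → Small n s
small-fun s ts (s≤s p) = ℕP.≤-trans (ℕP.m≤m+n (size s) (sizeₘ ts)) p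

small-arg : ∀ {n} s ts → Small (suc n) (app s ts) → All (Small n) ts
small-arg s ts (s≤s p) = sizeₘ-bound ts (ℕP.≤-trans (ℕP.m≤n+m (sizeₘ ts) (size s)) p)

-- ≈ is an equivalence on terms of size ≤ n, by induction on n: the
-- argument monomials of an application are smaller, so BagOn applies.
mutual
  equivOn-small : ∀ n → EquivOn (Small n)
  equivOn-small n = record { sym-on = ≈-sym-small n ; trans-on = ≈-trans-small n }

  ≈-sym-small : ∀ n {x y} → Small n x → Small n y → x ≈ y → y ≈ x
  ≈-sym-small n {x} {y} px py e with sameHead x y e
  ... | var i j with ≟-sound {i} {j} e
  ...   | refl = ≟-refl i
  ≈-sym-small (suc n) (s≤s px) (s≤s py) e | lam s t   = ≈-sym-small n px py e
  ≈-sym-small (suc n) (s≤s px) (s≤s py) e | left s t  = ≈-sym-small n px py e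
  ≈-sym-small (suc n) (s≤s px) (s≤s py) e | right s t = ≈-sym-small n px py e
  ≈-sym-small (suc n) px py e | app s ts t us =
    true-∧ (≈-sym-small n (small-fun s ts px) (small-fun t us py) (proj₁ (∧-true e)))
           (BagOn.bag-sym (equivOn-small n) ts us (small-arg s ts px) (small-arg t us py) (proj₂ (∧-true {s ≈ᵇ t} e)))

  ≈-trans-small : ∀ n {x y z} → Small n x → Small n y → Small n z → x ≈ y → y ≈ z → x ≈ z
  ≈-trans-small n {x} {y} {z} px py pz e₁ e₂ with sameHead x y e₁ | sameHead y z e₂
  ... | var i j | var .j k with ≟-sound {i} {j} e₁ | ≟-sound {j} {k} e₂
  ...   | refl | refl = e₁
  ≈-trans-small (suc n) (s≤s px) (s≤s py) (s≤s pz) e₁ e₂ | lam _ _   | lam _ _   = ≈-trans-small n px py pz e₁ e₂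
  ≈-trans-small (suc n) (s≤s px) (s≤s py) (s≤s pz) e₁ e₂ | left _ _  | left _ _  = ≈-trans-small n px py pz e₁ e₂
  ≈-trans-small (suc n) (s≤s px) (s≤s py) (s≤s pz) e₁ e₂ | right _ _ | right _ _ = ≈-trans-small n px py pz e₁ e₂
  ≈-trans-small (suc n) px py pz e₁ e₂ | app s ts t us | app .t .us w ws =
    true-∧ (≈-trans-small n (small-fun s ts px) (small-fun t us py) (small-fun w ws pz)
                          (proj₁ (∧-true e₁)) (proj₁ (∧-true e₂)))
           (BagOn.bag-trans (equivOn-small n) ts us ws (small-arg s ts px) (small-arg t us py) (small-arg w ws pz)
                            (proj₂ (∧-true {s ≈ᵇ t} e₁)) (proj₂ (∧-true {t ≈ᵇ w} e₂)))

≈-sym : ∀ x y → x ≈ y → y ≈ x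
≈-sym x y = ≈-sym-small (size x ⊔ size y) (ℕP.m≤m⊔n (size x) (size y)) (ℕP.m≤n⊔m (size x) (size y))

≈-trans : ∀ x y z → x ≈ y → y ≈ z → x ≈ z
≈-trans x y z = ≈-trans-small n (ℕP.≤-trans (ℕP.m≤m⊔n (size x) (size y)) (ℕP.m≤m⊔n _ (size z)))
                                (ℕP.≤-trans (ℕP.m≤n⊔m (size x) (size y)) (ℕP.m≤m⊔n _ (size z)))
                                (ℕP.m≤n⊔m (size x ⊔ size y) (size z))
  where n = size x ⊔ size y ⊔ size z

-- Instantiating BagOn with the trivial predicate gives the unrestricted
-- consequences: ≈ᵇ respects ≈ on both sides, and so do counts.
Anything : RTerm → Set
Anything _ = ⊤

everything : ∀ xs → All Anything xs
everything []       = []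
everything (_ ∷ xs) = tt ∷ everything xs

equiv : EquivOn Anything
equiv = record { sym-on = λ {x} {y} _ _ → ≈-sym x y ; trans-on = λ {x} {y} {z} _ _ _ → ≈-trans x y z }

≈ᵇ-congʳ : ∀ z a b → a ≈ b → z ≈ᵇ a ≡ z ≈ᵇ b
≈ᵇ-congʳ z a b = BagOn.≈ᵇ-congʳ-on equiv {z} {a} {b} tt tt tt

≈ᵇ-congˡ : ∀ x a b → a ≈ b → a ≈ᵇ x ≡ b ≈ᵇ x
≈ᵇ-congˡ x a b e = bool-ext (λ ax → ≈-trans b a x (≈-sym a b e) ax) (λ bx → ≈-trans a b x e bx)

≉-sym : ∀ a b → a ≉ b → b ≉ a
≉-sym a b f with b ≈ᵇ a in ba
... | false = refl
... | true  = ⊥-elim (true≢false (trans (sym (≈-sym b a ba)) f))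
  where
  true≢false : true ≡ false → ⊥
  true≢false ()

≉-respˡ : ∀ a b c → a ≉ b → a ≈ c → c ≉ b
≉-respˡ a b c f e = trans (sym (≈ᵇ-congˡ b a c e)) f

count-cong : ∀ a b xs → a ≈ b → count a xs ≡ count b xs
count-cong a b []       e = refl
count-cong a b (x ∷ xs) e = cong₂ bump (≈ᵇ-congˡ x a b e) (count-cong a b xs e)

bag⇒count : ∀ xs ys → xs ≈ₘ ys ≡ true → ∀ z → count z xs ≡ count z ys
bag⇒count xs ys e z = BagOn.bag⇒count equiv xs ys (everything xs) (everything ys) e z tt

-- stab ts = ∏ᵢ (1 + number of later copies of tᵢ) = ∏ over distinct t of
-- (count t ts)!, the number of permutations of ts fixing it as a list up to ≈.
stab : Monomial → ℕ
stab []       = 1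
stab (u ∷ us) = suc (count u us) ℕ.* stab us

stab-nz : ∀ ts → NonZero (stab ts)
stab-nz []       = _
stab-nz (u ∷ us) = ℕP.m*n≢0 (suc (count u us)) (stab us) {{_}} {{stab-nz us}}

stab-del : ∀ {t u ys ys′} → t ≈ u → Del u ys ys′ → stab ys ≡ count t ys ℕ.* stab ys′
stab-del {t} {u} {_} {ys′} t≈u here =
  cong (ℕ._* stab ys′) (sym (trans (bump-true (count t ys′) t≈u) (cong suc (count-cong t u ys′ t≈u))))
stab-del {t} {u} {y ∷ ys} {y ∷ ys′} t≈u (there d) with y ≈ᵇ u in y≈?u
... | true = begin
  suc (count y ys) ℕ.* stab ys                                 ≡⟨ cong (suc (count y ys) ℕ.*_) (stab-del t≈u d) ⟩
  suc (count y ys) ℕ.* (count t ys ℕ.* stab ys′)                ≡⟨ cong (λ a → suc a ℕ.* (count t ys ℕ.* stab ys′)) y-ys ⟩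
  suc (suc (count y ys′)) ℕ.* (count t ys ℕ.* stab ys′)         ≡⟨ cong (λ a → suc (suc (count y ys′)) ℕ.* (a ℕ.* stab ys′)) t-ys ⟩
  suc (suc (count y ys′)) ℕ.* (suc (count y ys′) ℕ.* stab ys′)  ≡⟨ cong (λ a → a ℕ.* (suc (count y ys′) ℕ.* stab ys′)) t-yys ⟨
  count t (y ∷ ys) ℕ.* (suc (count y ys′) ℕ.* stab ys′)         ∎
  where
  open ≡-Reasoning
  t≈y : t ≈ y
  t≈y = ≈-trans t u y t≈u (≈-sym y u y≈?u)
  y-ys : count y ys ≡ suc (count y ys′)
  y-ys = trans (del-count d y) (bump-true _ y≈?u)
  t-ys : count t ys ≡ suc (count y ys′)
  t-ys = trans (count-cong t y ys t≈y) y-ys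
  t-yys : count t (y ∷ ys) ≡ suc (suc (count y ys′))
  t-yys = trans (bump-true (count t ys) t≈y) (cong suc t-ys)
... | false = begin
  suc (count y ys) ℕ.* stab ys                          ≡⟨ cong (suc (count y ys) ℕ.*_) (stab-del t≈u d) ⟩
  suc (count y ys) ℕ.* (count t ys ℕ.* stab ys′)         ≡⟨ cong (λ a → suc a ℕ.* (count t ys ℕ.* stab ys′)) y-ys ⟩
  suc (count y ys′) ℕ.* (count t ys ℕ.* stab ys′)        ≡⟨ x∙yz≈y∙xz (suc (count y ys′)) (count t ys) (stab ys′) ⟩
  count t ys ℕ.* (suc (count y ys′) ℕ.* stab ys′)        ≡⟨ cong (λ a → a ℕ.* (suc (count y ys′) ℕ.* stab ys′)) t-yys ⟨
  count t (y ∷ ys) ℕ.* (suc (count y ys′) ℕ.* stab ys′)  ∎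
  where
  open ≡-Reasoning
  y-ys : count y ys ≡ count y ys′
  y-ys = trans (del-count d y) (bump-false _ y≈?u)
  t-yys : count t (y ∷ ys) ≡ count t ys
  t-yys = bump-false (count t ys) (≉-respˡ u y t (≉-sym y u y≈?u) (≈-sym t u t≈u))

bag⇒stab : ∀ ts us → ts ≈ₘ us ≡ true → stab ts ≡ stab us
bag⇒stab []       []      _ = refl
bag⇒stab (x ∷ xs) ys e = step (removeOne x ys) (removeOne-view x ys) (trans (sym (≈ₘ-∷ x xs ys)) e)
  where
  step : (r : Maybe Monomial) → RemoveOne x ys r → ≈ₘ-after xs r ≡ true → stab (x ∷ xs) ≡ stab ys
  step (just ys′) (found u .ys′ x≈u d) e′ =
    trans (cong₂ ℕ._*_ (trans (sym (count-∷-self x xs)) (bag⇒count (x ∷ xs) ys e x)) (bag⇒stab xs ys′ e′))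
          (sym (stab-del x≈u d))

elemOf-true : ∀ u us → elemOf u us ≡ true → ∃ λ w → w ∈ us × u ≈ w
elemOf-true u (v ∷ us) e with u ≈ᵇ v in u≈?v
... | true  = v , here refl , u≈?v
... | false with elemOf-true u us e
...   | w , w∈us , u≈w = w , there w∈us , u≈w

elemOf-false : ∀ u us → elemOf u us ≡ false → All (u ≉_) us
elemOf-false u []       e = []
elemOf-false u (v ∷ us) e with u ≈ᵇ v in u≈?v
... | false = u≈?v ∷ elemOf-false u us e

distinct-⊆ : ∀ {t} ts → t ∈ distinct ts → t ∈ ts
distinct-⊆ (u ∷ us) m with elemOf u us
... | true = there (distinct-⊆ us m)
distinct-⊆ (u ∷ us) (here refl) | false = here refl
distinct-⊆ (u ∷ us) (there m)   | false = there (distinct-⊆ us m)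

distinct-covers : ∀ {w} ts → w ∈ ts → ∃ λ t → t ∈ distinct ts × t ≈ w
distinct-covers (u ∷ us) m with elemOf u us in eq
distinct-covers (u ∷ us) (here refl) | true with elemOf-true u us eq
... | w′ , w′∈us , u≈w′ with distinct-covers us w′∈us
...   | t , t∈d , t≈w′ = t , t∈d , ≈-trans t w′ u t≈w′ (≈-sym u w′ u≈w′)
distinct-covers (u ∷ us) (there m)   | true  = distinct-covers us m
distinct-covers (u ∷ us) (here refl) | false = u , here refl , ≈-refl u
distinct-covers (u ∷ us) (there m)   | false with distinct-covers us m
... | t , t∈d , t≈w = t , there t∈d , t≈w

distinct-pairwise : ∀ ts → AllPairs _≉_ (distinct ts)
distinct-pairwise []       = []
distinct-pairwise (u ∷ us) with elemOf u us in eq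
... | true  = distinct-pairwise us
... | false = All.tabulate (λ m → All.lookup (elemOf-false u us eq) (distinct-⊆ us m)) ∷ distinct-pairwise us

absent-from-distinct : ∀ u us → elemOf u us ≡ false → All (_≉ u) (distinct us)
absent-from-distinct u us eq = All.tabulate (λ {x} m → ≉-sym u x (All.lookup (elemOf-false u us eq) (distinct-⊆ us m)))

others-≉ : ∀ d u ds → All (d ≉_) ds → d ≈ u → All (_≉ u) ds
others-≉ d u []       []       _   = []
others-≉ d u (e ∷ ds) (f ∷ fs) d≈u = ≉-sym u e (≉-respˡ d e u f d≈u) ∷ others-≉ d u ds fs d≈u

head-≉ : ∀ {d t u ds} → All (d ≉_) ds → t ∈ ds → t ≈ u → d ≉ u
head-≉ {d} {t} {u} fs t∈ds t≈u = ≉-sym u d (≉-respˡ t d u (≉-sym d t (All.lookup fs t∈ds)) t≈u)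

distinct-rep : ∀ u us → elemOf u us ≡ true → ∃ λ t → t ∈ distinct us × t ≈ u
distinct-rep u us eq with elemOf-true u us eq
... | w , w∈us , u≈w with distinct-covers us w∈us
...   | t , t∈d , t≈w = t , t∈d , ≈-trans t w u t≈w (≈-sym u w u≈w)

count-zero : ∀ {u us} → All (u ≉_) us → count u us ≡ 0
count-zero              []       = refl
count-zero {u} {v ∷ vs} (f ∷ fs) = trans (bump-false (count u vs) f) (count-zero fs)

countSum : Monomial → Monomial → ℕ
countSum ts []       = 0
countSum ts (d ∷ ds) = count d ts ℕ.+ countSum ts ds

factProd-∷-≉ : ∀ u us ds → All (_≉ u) ds → factProd (u ∷ us) ds ≡ factProd us ds
factProd-∷-≉ u us []       _        = refl
factProd-∷-≉ u us (d ∷ ds) (f ∷ fs) = cong₂ ℕ._*_ (cong _! (bump-false (count d us) f)) (factProd-∷-≉ u us ds fs)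

countSum-∷-≉ : ∀ u us ds → All (_≉ u) ds → countSum (u ∷ us) ds ≡ countSum us ds
countSum-∷-≉ u us []       _        = refl
countSum-∷-≉ u us (d ∷ ds) (f ∷ fs) = cong₂ ℕ._+_ (bump-false (count d us) f) (countSum-∷-≉ u us ds fs)

factProd-∷-≈ : ∀ u us ds {t} → AllPairs _≉_ ds → t ∈ ds → t ≈ u →
               factProd (u ∷ us) ds ≡ suc (count u us) ℕ.* factProd us ds
factProd-∷-≈ u us (d ∷ ds) (fs ∷ _) (here refl) d≈u = begin
  count d (u ∷ us) ! ℕ.* factProd (u ∷ us) ds        ≡⟨ cong₂ (λ a b → a ! ℕ.* b) d-uus (factProd-∷-≉ u us ds (others-≉ d u ds fs d≈u)) ⟩
  (suc (count u us) ℕ.* count u us !) ℕ.* factProd us ds ≡⟨ ℕP.*-assoc (suc (count u us)) (count u us !) (factProd us ds) ⟩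
  suc (count u us) ℕ.* (count u us ! ℕ.* factProd us ds) ≡⟨ cong (λ a → suc (count u us) ℕ.* (a ! ℕ.* factProd us ds)) (count-cong d u us d≈u) ⟨
  suc (count u us) ℕ.* (count d us ! ℕ.* factProd us ds) ∎
  where
  open ≡-Reasoning
  d-uus : count d (u ∷ us) ≡ suc (count u us)
  d-uus = trans (bump-true (count d us) d≈u) (cong suc (count-cong d u us d≈u))
factProd-∷-≈ u us (d ∷ ds) (fs ∷ ps) (there t∈ds) t≈u = begin
  count d (u ∷ us) ! ℕ.* factProd (u ∷ us) ds            ≡⟨ cong₂ (λ a b → a ! ℕ.* b) (bump-false (count d us) (head-≉ {d} fs t∈ds t≈u))
                                                                  (factProd-∷-≈ u us ds ps t∈ds t≈u) ⟩
  count d us ! ℕ.* (suc (count u us) ℕ.* factProd us ds) ≡⟨ x∙yz≈y∙xz (count d us !) (suc (count u us)) (factProd us ds) ⟩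
  suc (count u us) ℕ.* (count d us ! ℕ.* factProd us ds) ∎
  where open ≡-Reasoning

countSum-∷-≈ : ∀ u us ds {t} → AllPairs _≉_ ds → t ∈ ds → t ≈ u → countSum (u ∷ us) ds ≡ suc (countSum us ds)
countSum-∷-≈ u us (d ∷ ds) (fs ∷ _) (here refl) d≈u =
  cong₂ ℕ._+_ (bump-true (count d us) d≈u) (countSum-∷-≉ u us ds (others-≉ d u ds fs d≈u))
countSum-∷-≈ u us (d ∷ ds) (fs ∷ ps) (there t∈ds) t≈u =
  trans (cong₂ ℕ._+_ (bump-false (count d us) (head-≉ {d} fs t∈ds t≈u)) (countSum-∷-≈ u us ds ps t∈ds t≈u)) (ℕP.+-suc _ _)

factProd-distinct : ∀ ts → factProd ts (distinct ts) ≡ stab ts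
factProd-distinct []       = refl
factProd-distinct (u ∷ us) with elemOf u us in eq
... | true with distinct-rep u us eq
...   | t , t∈d , t≈u = trans (factProd-∷-≈ u us (distinct us) (distinct-pairwise us) t∈d t≈u)
                              (cong (suc (count u us) ℕ.*_) (factProd-distinct us))
factProd-distinct (u ∷ us) | false = begin
  count u (u ∷ us) ! ℕ.* factProd (u ∷ us) (distinct us) ≡⟨ cong₂ (λ a b → a ! ℕ.* b) u-uus
     (trans (factProd-∷-≉ u us (distinct us) (absent-from-distinct u us eq)) (factProd-distinct us)) ⟩
  1 ! ℕ.* stab us                                         ≡⟨ cong (λ a → suc a ℕ.* stab us) u-us ⟨
  suc (count u us) ℕ.* stab us                            ∎
  where
  open ≡-Reasoning
  u-us : count u us ≡ 0
  u-us = count-zero (elemOf-false u us eq)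
  u-uus : count u (u ∷ us) ≡ 1
  u-uus = trans (count-∷-self u us) (cong suc u-us)

-- Every occurrence is counted exactly once by its representative.
countSum-distinct : ∀ ts → countSum ts (distinct ts) ≡ length ts
countSum-distinct []       = refl
countSum-distinct (u ∷ us) with elemOf u us in eq
... | true with distinct-rep u us eq
...   | t , t∈d , t≈u = trans (countSum-∷-≈ u us (distinct us) (distinct-pairwise us) t∈d t≈u)
                              (cong suc (countSum-distinct us))
countSum-distinct (u ∷ us) | false =
  cong₂ ℕ._+_ (trans (count-∷-self u us) (cong suc (count-zero (elemOf-false u us eq))))
              (trans (countSum-∷-≉ u us (distinct us) (absent-from-distinct u us eq)) (countSum-distinct us))

Invariant : V RTerm → Set
Invariant S = ∀ a b → a ≈ b → S a ≡ S b

prodV : V RTerm → Monomial → ℚ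
prodV S []       = 1ℚ
prodV S (u ∷ us) = S u ℚ.* prodV S us

prodV-del : ∀ S {u ys ys′} → Del u ys ys′ → prodV S ys ≡ S u ℚ.* prodV S ys′
prodV-del S here = refl
prodV-del S {u} (there {y} {ys} {ys′} d) = trans (cong (S y ℚ.*_) (prodV-del S d))
  (solve 3 (λ a b c → a :* (b :* c) := b :* (a :* c)) refl (S y) (S u) (prodV S ys′))

bag⇒prodV : ∀ {S} → Invariant S → ∀ ts us → ts ≈ₘ us ≡ true → prodV S ts ≡ prodV S us
bag⇒prodV S-inv []       []      _ = refl
bag⇒prodV {S} S-inv (x ∷ xs) ys e = step (removeOne x ys) (removeOne-view x ys) (trans (sym (≈ₘ-∷ x xs ys)) e)
  where
  step : (r : Maybe Monomial) → RemoveOne x ys r → ≈ₘ-after xs r ≡ true → prodV S (x ∷ xs) ≡ prodV S ys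
  step (just ys′) (found u .ys′ x≈u d) e′ =
    trans (cong₂ ℚ._*_ (S-inv x u x≈u) (bag⇒prodV S-inv xs ys′ e′)) (sym (prodV-del S d))

sumℚ-*ʳ : ∀ (F : RTerm → ℚ) c xs → sumℚ (mapL F xs) ℚ.* c ≡ sumℚ (mapL (λ x → F x ℚ.* c) xs)
sumℚ-*ʳ F c []       = ℚP.*-zeroˡ c
sumℚ-*ʳ F c (x ∷ xs) = trans (ℚP.*-distribʳ-+ c (F x) _) (cong (F x ℚ.* c ℚ.+_) (sumℚ-*ʳ F c xs))

mapL-cong-∈ : ∀ {F G : RTerm → ℚ} xs → (∀ x → x ∈ xs → F x ≡ G x) → mapL F xs ≡ mapL G xs
mapL-cong-∈ []       h = refl
mapL-cong-∈ (x ∷ xs) h = cong₂ _∷_ (h x (here refl)) (mapL-cong-∈ xs (λ y m → h y (there m)))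

sumℚ-countSum : ∀ ts K ds → sumℚ (mapL (λ d → ι (count d ts) ℚ.* K) ds) ≡ ι (countSum ts ds) ℚ.* K
sumℚ-countSum ts K []       = sym (ℚP.*-zeroˡ K)
sumℚ-countSum ts K (d ∷ ds) = trans (cong (ι (count d ts) ℚ.* K ℚ.+_) (sumℚ-countSum ts K ds))
  (trans (sym (ℚP.*-distribʳ-+ K (ι (count d ts)) (ι (countSum ts ds))))
         (cong (ℚ._* K) (sym (ι-+ (count d ts) (countSum ts ds)))))

-- The coefficient of Sⁿ at a monomial t̄ of length n is n! ∏ S(tᵢ) / stab t̄.
-- (By the recursion defining [S₁,…,Sₙ], each distinct t ∈ t̄ contributes
-- count t t̄ times the coefficient for t̄ ∖ t, up to stab.)
module Powers (S : V RTerm) (S-inv : Invariant S) where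

  -- The statement for exponent k, weighted by stab to stay in ℕ-multiples.
  PowCoeff : ℕ → Set
  PowCoeff k = ∀ ts → length ts ≡ k → powV S k ts ℚ.* ι (stab ts) ≡ ι (k !) ℚ.* prodV S ts

  powV-summand : ∀ {k} → PowCoeff k → ∀ ts → length ts ≡ suc k → ∀ x → x ∈ distinct ts →
                 (S x ℚ.* powV S k (ts ∖ x)) ℚ.* ι (stab ts) ≡ ι (count x ts) ℚ.* (ι (k !) ℚ.* prodV S ts)
  powV-summand {k} ih ts len x x∈d with removeOne-∈ x ts (distinct-⊆ ts x∈d)
  ... | u , ts′ , rem , x≈u , d = begin
    (S x ℚ.* powV S k (ts ∖ x)) ℚ.* ι (stab ts)                ≡⟨ cong₂ (λ a b → (S x ℚ.* powV S k a) ℚ.* ι b)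
                                                                         (∖-removeOne ts x ts′ rem) (stab-del x≈u d) ⟩
    (S x ℚ.* P′) ℚ.* ι (c ℕ.* stab ts′)                        ≡⟨ cong ((S x ℚ.* P′) ℚ.*_) (ι-* c (stab ts′)) ⟩
    (S x ℚ.* P′) ℚ.* (ι c ℚ.* ι (stab ts′))                    ≡⟨ solve 4 (λ a b e q → (a :* b) :* (e :* q) := (e :* a) :* (b :* q))
                                                                         refl (S x) P′ (ι c) (ι (stab ts′)) ⟩
    (ι c ℚ.* S x) ℚ.* (P′ ℚ.* ι (stab ts′))                    ≡⟨ cong ((ι c ℚ.* S x) ℚ.*_) (ih ts′ len′) ⟩
    (ι c ℚ.* S x) ℚ.* (ι (k !) ℚ.* prodV S ts′)                ≡⟨ solve 4 (λ e a f p → (e :* a) :* (f :* p) := e :* (f :* (a :* p)))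
                                                                         refl (ι c) (S x) (ι (k !)) (prodV S ts′) ⟩
    ι c ℚ.* (ι (k !) ℚ.* (S x ℚ.* prodV S ts′))                ≡⟨ cong (λ a → ι c ℚ.* (ι (k !) ℚ.* (a ℚ.* prodV S ts′))) (S-inv x u x≈u) ⟩
    ι c ℚ.* (ι (k !) ℚ.* (S u ℚ.* prodV S ts′))                ≡⟨ cong (λ a → ι c ℚ.* (ι (k !) ℚ.* a)) (prodV-del S d) ⟨
    ι c ℚ.* (ι (k !) ℚ.* prodV S ts)                           ∎
    where
    open ≡-Reasoning
    c  = count x ts
    P′ = powV S k ts′
    len′ : length ts′ ≡ k
    len′ = ℕP.suc-injective (trans (sym (del-length d)) len)

  powV-coeff : ∀ k → PowCoeff k
  powV-coeff zero    []       _   = refl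
  powV-coeff (suc k) ts@(_ ∷ _) len = begin
    sumℚ (mapL F (distinct ts)) ℚ.* ι (stab ts)                       ≡⟨ sumℚ-*ʳ F _ (distinct ts) ⟩
    sumℚ (mapL (λ x → F x ℚ.* ι (stab ts)) (distinct ts))             ≡⟨ cong sumℚ (mapL-cong-∈ (distinct ts)
                                                                            (powV-summand (powV-coeff k) ts len)) ⟩
    sumℚ (mapL (λ x → ι (count x ts) ℚ.* K) (distinct ts))            ≡⟨ sumℚ-countSum ts K (distinct ts) ⟩
    ι (countSum ts (distinct ts)) ℚ.* K                               ≡⟨ cong (λ n → ι n ℚ.* K) (trans (countSum-distinct ts) len) ⟩
    ι (suc k) ℚ.* (ι (k !) ℚ.* prodV S ts)                            ≡⟨ ℚP.*-assoc (ι (suc k)) _ _ ⟨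
    (ι (suc k) ℚ.* ι (k !)) ℚ.* prodV S ts                            ≡⟨ cong (ℚ._* prodV S ts) (ι-* (suc k) (k !)) ⟨
    ι (suc k !) ℚ.* prodV S ts                                        ∎
    where
    open ≡-Reasoning
    F : RTerm → ℚ
    F t = S t ℚ.* powV S k (ts ∖ t)
    K : ℚ
    K = ι (k !) ℚ.* prodV S ts

  bangV-coeff : ∀ ts → bangV S ts ≡ prodV S ts ℚ.* recip (stab ts) {{stab-nz ts}}
  bangV-coeff ts = recip-solve (stab ts) {{stab-nz ts}} (bangV S ts) (begin
    (recip (n !) ℚ.* powV S n ts) ℚ.* ι (stab ts)     ≡⟨ ℚP.*-assoc (recip (n !)) _ _ ⟩
    recip (n !) ℚ.* (powV S n ts ℚ.* ι (stab ts))     ≡⟨ cong (recip (n !) ℚ.*_) (powV-coeff n ts refl) ⟩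
    recip (n !) ℚ.* (ι (n !) ℚ.* prodV S ts)          ≡⟨ ℚP.*-assoc (recip (n !)) _ _ ⟨
    (recip (n !) ℚ.* ι (n !)) ℚ.* prodV S ts          ≡⟨ cong (ℚ._* prodV S ts) (recip-inverse (n !)) ⟩
    1ℚ ℚ.* prodV S ts                                 ≡⟨ ℚP.*-identityˡ _ ⟩
    prodV S ts                                        ∎)
    where
    open ≡-Reasoning
    n = length ts
    instance
      n!≢0 : NonZero (n !)
      n!≢0 = n !≢0

  bangV-invariant : ∀ ts us → ts ≈ₘ us ≡ true → bangV S ts ≡ bangV S us
  bangV-invariant ts us e = begin
    bangV S ts                                                ≡⟨ bangV-coeff ts ⟩
    prodV S ts ℚ.* recip (stab ts) {{stab-nz ts}}             ≡⟨ cong₂ ℚ._*_ (bag⇒prodV S-inv ts us e)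
                                                                   (recip-cong (bag⇒stab ts us e) {{stab-nz ts}} {{stab-nz us}}) ⟩
    prodV S us ℚ.* recip (stab us) {{stab-nz us}}             ≡⟨ bangV-coeff us ⟨
    bangV S us                                                ∎
    where open ≡-Reasoning

T-invariant : ∀ M → Invariant (T M)
T-invariant (var i) a b e = cong (λ c → if c then 1ℚ else 0ℚ) (≈ᵇ-congʳ (var i) a b e)
T-invariant (lam N) a b e with sameHead a b e
... | var _ _     = refl
... | lam s t     = T-invariant N s t e
... | app _ _ _ _ = refl
... | left _ _    = refl
... | right _ _   = refl
T-invariant (P ⊕ Q) a b e with sameHead a b e
... | var _ _     = refl
... | lam _ _     = refl
... | app _ _ _ _ = refl
... | left s t    = cong (ℚ._+ 0ℚ) (T-invariant P s t e)
... | right s t   = cong (0ℚ ℚ.+_) (T-invariant Q s t e)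
T-invariant (app P Q) a b e with sameHead a b e
... | var _ _       = refl
... | lam _ _       = refl
... | left _ _      = refl
... | right _ _     = refl
... | app s ts t us =
  cong₂ ℚ._*_ (T-invariant P s t (proj₁ (∧-true e)))
              (Powers.bangV-invariant (T Q) (T-invariant Q) ts us (proj₂ (∧-true {s ≈ᵇ t} e)))

Exact : V RTerm → Set
Exact S = ∀ s → ¬ (S s ≡ 0ℚ) → S s ≡ recip (m s) {{m-nz s}}

Exactₘ : V Monomial → Set
Exactₘ B = ∀ ts → ¬ (B ts ≡ 0ℚ) → B ts ≡ recip (mₘ ts) {{mₘ-nz ts}}

≡0⇒*≡0ˡ : ∀ {x} y → x ≡ 0ℚ → x ℚ.* y ≡ 0ℚ
≡0⇒*≡0ˡ y refl = ℚP.*-zeroˡ y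

≡0⇒*≡0ʳ : ∀ x {y} → y ≡ 0ℚ → x ℚ.* y ≡ 0ℚ
≡0⇒*≡0ʳ x refl = ℚP.*-zeroʳ x

δ-exact : ∀ i → Exact (δ (var i))
δ-exact i s nz with var i ≈ᵇ s in eq
... | false = ⊥-elim (nz refl)
... | true with sameHead (var i) s eq
...   | var .i j = refl

lamV-exact : ∀ {S} → Exact S → Exact (lamV S)
lamV-exact S-exact (lam s)   nz = S-exact s nz
lamV-exact S-exact (var _)   nz = ⊥-elim (nz refl)
lamV-exact S-exact (app _ _) nz = ⊥-elim (nz refl)
lamV-exact S-exact (left _)  nz = ⊥-elim (nz refl)
lamV-exact S-exact (right _) nz = ⊥-elim (nz refl)

⊕-exact : ∀ {S S′} → Exact S → Exact S′ → Exact (λ s → leftV S s ℚ.+ rightV S′ s)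
⊕-exact {S}  S-exact S′-exact (left s)  nz =
  trans (ℚP.+-identityʳ _) (S-exact s (λ z → nz (trans (ℚP.+-identityʳ (S s)) z)))
⊕-exact {S′ = S′} S-exact S′-exact (right s) nz =
  trans (ℚP.+-identityˡ _) (S′-exact s (λ z → nz (trans (ℚP.+-identityˡ (S′ s)) z)))
⊕-exact S-exact S′-exact (var _)   nz = ⊥-elim (nz (ℚP.+-identityʳ 0ℚ))
⊕-exact S-exact S′-exact (lam _)   nz = ⊥-elim (nz (ℚP.+-identityʳ 0ℚ))
⊕-exact S-exact S′-exact (app _ _) nz = ⊥-elim (nz (ℚP.+-identityʳ 0ℚ))

appV-exact : ∀ {S B} → Exact S → Exactₘ B → Exact (appV S B)
appV-exact {S} {B} S-exact B-exact (app s ts) nz = begin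
  S s ℚ.* B ts                                       ≡⟨ cong₂ ℚ._*_ (S-exact s (λ z → nz (≡0⇒*≡0ˡ (B ts) z)))
                                                                    (B-exact ts (λ z → nz (≡0⇒*≡0ʳ (S s) z))) ⟩
  recip (m s) {{m-nz s}} ℚ.* recip (mₘ ts) {{mₘ-nz ts}} ≡⟨ recip-* (m s) (mₘ ts) {{m-nz s}} {{mₘ-nz ts}} {{m-nz (app s ts)}} ⟩
  recip (m (app s ts)) {{m-nz (app s ts)}}           ∎
  where open ≡-Reasoning
appV-exact S-exact B-exact (var _)   nz = ⊥-elim (nz refl)
appV-exact S-exact B-exact (lam _)   nz = ⊥-elim (nz refl)
appV-exact S-exact B-exact (left _)  nz = ⊥-elim (nz refl)
appV-exact S-exact B-exact (right _) nz = ⊥-elim (nz refl)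

prodV-exact : ∀ {S} → Exact S → ∀ ts → ¬ (prodV S ts ≡ 0ℚ) → prodV S ts ≡ recip (mList ts) {{mList-nz ts}}
prodV-exact S-exact []       _  = refl
prodV-exact {S} S-exact (u ∷ us) nz = begin
  S u ℚ.* prodV S us                                        ≡⟨ cong₂ ℚ._*_ (S-exact u (λ z → nz (≡0⇒*≡0ˡ (prodV S us) z)))
                                                                         (prodV-exact S-exact us (λ z → nz (≡0⇒*≡0ʳ (S u) z))) ⟩
  recip (m u) {{m-nz u}} ℚ.* recip (mList us) {{mList-nz us}} ≡⟨ recip-* (m u) (mList us) {{m-nz u}} {{mList-nz us}} {{mList-nz (u ∷ us)}} ⟩
  recip (mList (u ∷ us)) {{mList-nz (u ∷ us)}}              ∎
  where open ≡-Reasoning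

-- m(t̄) = stab(t̄)·∏ m(tᵢ), which matches the closed form of S^!.
bangV-exact : ∀ {S} → Invariant S → Exact S → Exactₘ (bangV S)
bangV-exact {S} S-inv S-exact ts nz = begin
  bangV S ts                                  ≡⟨ Powers.bangV-coeff S S-inv ts ⟩
  prodV S ts ℚ.* recip (stab ts)              ≡⟨ cong (ℚ._* recip (stab ts)) (prodV-exact S-exact ts nzΠ) ⟩
  recip (mList ts) ℚ.* recip (stab ts)        ≡⟨ recip-* (mList ts) (stab ts) ⟩
  recip (mList ts ℕ.* stab ts)                ≡⟨ recip-cong mList*stab≡mₘ {{ℕP.m*n≢0 (mList ts) (stab ts)}} {{mₘ-nz ts}} ⟩
  recip (mₘ ts) {{mₘ-nz ts}}                  ∎
  where
  open ≡-Reasoning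
  instance
    _ : NonZero (mList ts)
    _ = mList-nz ts
    _ : NonZero (stab ts)
    _ = stab-nz ts
    _ : NonZero (mList ts ℕ.* stab ts)
    _ = ℕP.m*n≢0 (mList ts) (stab ts)
  nzΠ : ¬ (prodV S ts ≡ 0ℚ)
  nzΠ z = nz (trans (Powers.bangV-coeff S S-inv ts) (≡0⇒*≡0ˡ (recip (stab ts)) z))
  mList*stab≡mₘ : mList ts ℕ.* stab ts ≡ mₘ ts
  mList*stab≡mₘ = trans (ℕP.*-comm (mList ts) (stab ts)) (cong (ℕ._* mList ts) (sym (factProd-distinct ts)))

theorem4p5 : (M : Λ) (s : RTerm) → s ∈𝒯 M → T M s ≡ ((+ 1) / m s) {{m-nz s}}
theorem4p5 (var i)   = δ-exact i
theorem4p5 (lam N)   = lamV-exact (theorem4p5 N)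
theorem4p5 (P ⊕ Q)   = ⊕-exact (theorem4p5 P) (theorem4p5 Q)
theorem4p5 (app P Q) = appV-exact (theorem4p5 P) (bangV-exact (T-invariant Q) (theorem4p5 Q))
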